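{- None of the graphs $K_5-e$, $F_1$, $F_2$, $F_3$, $F_4$ is a proper $2$-color-line graph.
   Context: $K_5-e$ is the complete graph on $5$ vertices minus one edge. Each $F_j$ has vertex set $\{a_1,a_2,a_3,b_1,b_2,b_3,u\}$ where $\{a_1,a_2,a_3\}$ and $\{b_1,b_2,b_3\}$ are triangles and $u$ is adjacent to all six other vertices; in $F_1$ there are no edges between $\{a_1,a_2,a_3\}$ and $\{b_1,b_2,b_3\}$; $F_2$ additionally has the edge $a_1b_1$; $F_3$ additionally has the edges $a_1b_1,a_2b_2$; $F_4$ additionally has the edges $a_1b_1,a_2b_2,a_3b_3$ (and no other edges between the triangles). An edge $2$-coloring $\phi:E(H)\to\{1,2\}$ is proper if any two distinct edges sharing an endvertex get different colors. For an edge-colored graph $(H,\phi)$, $\mathrm{CL}(H)$ has vertex set $E(H)$, two distinct vertices being adjacent iff the corresponding edges share an endvertex or have the same color. $G$ is a proper $2$-color-line graph if $G\cong\mathrm{CL}(H)$ for some graph $H$ with a proper edge $2$-coloring. -}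

module Defs where

open import Data.Nat using (ℕ; zero; suc)
open import Data.Nat as ℕ using ()
open import Data.Bool using (Bool; true; false; not; _∧_; _∨_)
open import Data.Fin using (Fin; toℕ; _<_)
open import Data.Fin.Properties using (_≟_)
open import Data.List using (List; []; _∷_)
open import Data.Bool.ListAction using (any)
open import Data.Product using (Σ; ∃; _×_; _,_; proj₁; proj₂)
open import Data.Sum using (_⊎_)
open import Relation.Binary.PropositionalEquality using (_≡_; _≢_)
open import Relation.Nullary.Decidable using (⌊_⌋)
open import Function.Bundles using (Inverse; _↔_)

-- A graph is given by a number of vertices n (vertex set Fin n) and a
-- Boolean "base" relation R; the adjacency is the symmetric, irreflexive
-- closure of R:  x ~ y  iff  x ≠ y and (R x y or R y x).
-- Every finite simple graph arises this way (take R = its adjacency).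

record Graph : Set where
  constructor mkGraph
  field
    n    : ℕ
    base : Fin n → Fin n → Bool

  adj : Fin n → Fin n → Bool
  adj x y = not ⌊ x ≟ y ⌋ ∧ (base x y ∨ base y x)

  Adj : Fin n → Fin n → Set
  Adj x y = adj x y ≡ true

  Edge : Set
  Edge = Σ (Fin n × Fin n) λ p → (proj₁ p < proj₂ p) × Adj (proj₁ p) (proj₂ p)

  left right : Edge → Fin n
  left  e = proj₁ (proj₁ e)
  right e = proj₂ (proj₁ e)

  ShareEnd : Edge → Edge → Set
  ShareEnd e f = (left e ≡ left f) ⊎ (left e ≡ right f)
               ⊎ (right e ≡ left f) ⊎ (right e ≡ right f)

open Graph public

Proper2Coloring : (H : Graph) → (Edge H → Fin 2) → Set
Proper2Coloring H φ = ∀ e f → e ≢ f → ShareEnd H e f → φ e ≢ φ f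

CLAdj : (H : Graph) → (Edge H → Fin 2) → Edge H → Edge H → Set
CLAdj H φ e f = e ≢ f × (ShareEnd H e f ⊎ φ e ≡ φ f)

IsoCL : (G H : Graph) → (Edge H → Fin 2) → Set
IsoCL G H φ =
  Σ (Fin (n G) ↔ Edge H) λ σ →
    ∀ x y → (Adj G x y → CLAdj H φ (Inverse.to σ x) (Inverse.to σ y))
          × (CLAdj H φ (Inverse.to σ x) (Inverse.to σ y) → Adj G x y)

IsProper2ColorLine : Graph → Set
IsProper2ColorLine G =
  ∃ λ (H : Graph) → ∃ λ (φ : Edge H → Fin 2) → Proper2Coloring H φ × IsoCL G H φ

infix 4 _==ℕ_
_==ℕ_ : ℕ → ℕ → Bool
zero  ==ℕ zero  = true
suc a ==ℕ suc b = a ==ℕ b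
_     ==ℕ _     = false

fromEdges : (n : ℕ) → List (ℕ × ℕ) → Graph
fromEdges n es = mkGraph n (λ x y → any (λ p → (proj₁ p ==ℕ toℕ x) ∧ (proj₂ p ==ℕ toℕ y)) es)

K5-e : Graph
K5-e = fromEdges 5
  ( (0 , 2) ∷ (0 , 3) ∷ (0 , 4) ∷ (1 , 2) ∷ (1 , 3) ∷ (1 , 4)
  ∷ (2 , 3) ∷ (2 , 4) ∷ (3 , 4) ∷ [] )

-- F_j : labels a1=0, a2=1, a3=2, b1=3, b2=4, b3=5, u=6.
F-core : List (ℕ × ℕ)
F-core =
  (0 , 1) ∷ (0 , 2) ∷ (1 , 2)
  ∷ (3 , 4) ∷ (3 , 5) ∷ (4 , 5)
  ∷ (6 , 0) ∷ (6 , 1) ∷ (6 , 2) ∷ (6 , 3) ∷ (6 , 4) ∷ (6 , 5) ∷ []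

F₁ F₂ F₃ F₄ : Graph
F₁ = fromEdges 7 F-core
F₂ = fromEdges 7 ((0 , 3) ∷ F-core)
F₃ = fromEdges 7 ((0 , 3) ∷ (1 , 4) ∷ F-core)
F₄ = fromEdges 7 ((0 , 3) ∷ (1 , 4) ∷ (2 , 5) ∷ F-core)

-- In CL(H, φ) with φ a proper 2-colouring, non-adjacent vertices get different colours,
-- and no vertex has three neighbours of the other colour: such neighbours are edges
-- meeting it, and at each of its two ends at most one edge has that colour.  In each of
-- the five graphs the non-edges pin the colouring down enough to produce such a claw.
module Submission where

open import Data.Bool using (true)
import Data.Bool.Properties as Bool
open import Data.Empty using (⊥; ⊥-elim)
open import Data.Fin using (Fin; zero; suc; #_)
open import Data.Fin.Properties using (_≟_; all?)
open import Data.Product using (_×_; _,_; proj₁; proj₂)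
open import Data.Sum using (_⊎_; inj₁; inj₂; [_,_])
open import Data.Vec using (_∷_; []; lookup)
open import Function.Bundles using (Inverse; Injection)
open import Function.Properties.Inverse using (↔⇒↣)
open import Relation.Binary.Definitions using (Decidable)
open import Relation.Binary.PropositionalEquality using (_≡_; _≢_; refl; sym; trans; ≢-sym)
open import Relation.Nullary using (¬_; Dec; yes; no)
open import Relation.Nullary.Decidable using (¬?; _×-dec_; _→-dec_; map′; from-yes)

open import Defs

≢-≢⇒≡ : {x y z : Fin 2} → x ≢ y → y ≢ z → x ≡ z
≢-≢⇒≡ {zero}     {zero}                x≢y _   = ⊥-elim (x≢y refl)
≢-≢⇒≡ {suc zero} {suc zero}            x≢y _   = ⊥-elim (x≢y refl)
≢-≢⇒≡ {zero}     {suc zero} {zero}     _   _   = refl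
≢-≢⇒≡ {suc zero} {zero}     {suc zero} _   _   = refl
≢-≢⇒≡ {zero}     {suc zero} {suc zero} _   y≢z = ⊥-elim (y≢z refl)
≢-≢⇒≡ {suc zero} {zero}     {zero}     _   y≢z = ⊥-elim (y≢z refl)

≡-or-≡ : {x y : Fin 2} → x ≢ y → ∀ z → z ≡ x ⊎ z ≡ y
≡-or-≡ {x} x≢y z with z ≟ x
... | yes z≡x = inj₁ z≡x
... | no  z≢x = inj₂ (≢-≢⇒≡ z≢x x≢y)

majority : (x y z : Fin 2) → x ≡ y ⊎ x ≡ z ⊎ y ≡ z
majority x y z with x ≟ y | x ≟ z
... | yes x≡y | _       = inj₁ x≡y
... | no  _   | yes x≡z = inj₂ (inj₁ x≡z)
... | no  x≢y | no  x≢z = inj₂ (inj₂ (≢-≢⇒≡ (≢-sym x≢y) x≢z))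

module _ (G : Graph) where

  Adj-sym : ∀ {x y} → Adj G x y → Adj G y x
  Adj-sym {x} {y} xy with x ≟ y | y ≟ x
  ... | no _    | no _    = trans (Bool.∨-comm (base G y x) (base G x y)) xy
  ... | no x≢y  | yes y≡x = ⊥-elim (x≢y (sym y≡x))
  ... | yes _   | _       with () ← xy

  Adj⇒≢ : ∀ {x y} → Adj G x y → x ≢ y
  Adj⇒≢ {x} xy refl with x ≟ x
  ... | yes _   with () ← xy
  ... | no  x≢x = x≢x refl

  Adj? : Decidable (Adj G)
  Adj? x y = adj G x y Bool.≟ true

allOffDiagonal? : ∀ {m} {P : Fin m → Fin m → Set} → (∀ i j → Dec (P i j)) →
                  Dec (∀ i j → i ≢ j → P i j)
allOffDiagonal? P? = all? λ i → all? λ j → ¬? (i ≟ j) →-dec P? i j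

module ProperEdgeColouring {H : Graph} {φ : Edge H → Fin 2} (proper : Proper2Coloring H φ) where

  Incident : Edge H → Fin (n H) → Set
  Incident f v = left H f ≡ v ⊎ right H f ≡ v

  ShareEnd⇒Incident : ∀ e f → ShareEnd H e f → Incident f (left H e) ⊎ Incident f (right H e)
  ShareEnd⇒Incident e f (inj₁ p)                = inj₁ (inj₁ (sym p))
  ShareEnd⇒Incident e f (inj₂ (inj₁ p))         = inj₁ (inj₂ (sym p))
  ShareEnd⇒Incident e f (inj₂ (inj₂ (inj₁ p))) = inj₂ (inj₁ (sym p))
  ShareEnd⇒Incident e f (inj₂ (inj₂ (inj₂ p))) = inj₂ (inj₂ (sym p))

  Incident⇒ShareEnd : ∀ {f g v} → Incident f v → Incident g v → ShareEnd H f g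
  Incident⇒ShareEnd (inj₁ p) (inj₁ q) = inj₁ (trans p (sym q))
  Incident⇒ShareEnd (inj₁ p) (inj₂ q) = inj₂ (inj₁ (trans p (sym q)))
  Incident⇒ShareEnd (inj₂ p) (inj₁ q) = inj₂ (inj₂ (inj₁ (trans p (sym q))))
  Incident⇒ShareEnd (inj₂ p) (inj₂ q) = inj₂ (inj₂ (inj₂ (trans p (sym q))))

  sameColour-Incident : ∀ {f g v k} → f ≢ g → φ f ≡ k → φ g ≡ k →
                        Incident f v → Incident g v → ⊥
  sameColour-Incident {f} {g} {v} f≢g fk gk fv gv =
    proper f g f≢g (Incident⇒ShareEnd {f} {g} {v} fv gv) (trans fk (sym gk))

  -- Each fᵢ contains one of the two ends of e, so two of them contain the same one.
  noThreeAlikeMeeting : ∀ {k} e f₁ f₂ f₃ → f₁ ≢ f₂ → f₁ ≢ f₃ → f₂ ≢ f₃ →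
                        φ f₁ ≡ k → φ f₂ ≡ k → φ f₃ ≡ k →
                        ShareEnd H e f₁ → ShareEnd H e f₂ → ShareEnd H e f₃ → ⊥
  noThreeAlikeMeeting e f₁ f₂ f₃ f₁≢f₂ f₁≢f₃ f₂≢f₃ c₁ c₂ c₃ s₁ s₂ s₃
    with ShareEnd⇒Incident e f₁ s₁ | ShareEnd⇒Incident e f₂ s₂ | ShareEnd⇒Incident e f₃ s₃
  ... | inj₁ i₁ | inj₁ i₂ | _       = sameColour-Incident f₁≢f₂ c₁ c₂ i₁ i₂
  ... | inj₂ i₁ | inj₂ i₂ | _       = sameColour-Incident f₁≢f₂ c₁ c₂ i₁ i₂
  ... | inj₁ i₁ | inj₂ _  | inj₁ i₃ = sameColour-Incident f₁≢f₃ c₁ c₃ i₁ i₃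
  ... | inj₂ i₁ | inj₁ _  | inj₂ i₃ = sameColour-Incident f₁≢f₃ c₁ c₃ i₁ i₃
  ... | inj₁ _  | inj₂ i₂ | inj₂ i₃ = sameColour-Incident f₂≢f₃ c₂ c₃ i₂ i₃
  ... | inj₂ _  | inj₁ i₂ | inj₁ i₃ = sameColour-Incident f₂≢f₃ c₂ c₃ i₂ i₃

module ColourLineGraph {G H : Graph} {φ : Edge H → Fin 2}
                       (proper : Proper2Coloring H φ) (G≅CL : IsoCL G H φ) where

  open ProperEdgeColouring {H} {φ} proper using (noThreeAlikeMeeting)

  private
    to : Fin (n G) → Edge H
    to = Inverse.to (proj₁ G≅CL)

    to-injective : ∀ {x y} → to x ≡ to y → x ≡ y
    to-injective = Injection.injective (↔⇒↣ (proj₁ G≅CL))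

    CLAdj⇒Adj : ∀ {x y} → CLAdj H φ (to x) (to y) → Adj G x y
    CLAdj⇒Adj {x} {y} = proj₂ (proj₂ G≅CL x y)

    Adj⇒CLAdj : ∀ {x y} → Adj G x y → CLAdj H φ (to x) (to y)
    Adj⇒CLAdj {x} {y} = proj₁ (proj₂ G≅CL x y)

  colour : Fin (n G) → Fin 2
  colour x = φ (to x)

  nonadjacent⇒colour≢ : ∀ {x y} → x ≢ y → ¬ Adj G x y → colour x ≢ colour y
  nonadjacent⇒colour≢ x≢y x≁y xy = x≁y (CLAdj⇒Adj ((λ p → x≢y (to-injective p)) , inj₂ xy))

  adjacent⇒ShareEnd : ∀ {x y} → Adj G x y → colour x ≢ colour y → ShareEnd H (to x) (to y)
  adjacent⇒ShareEnd x~y x≉y with proj₂ (Adj⇒CLAdj x~y)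
  ... | inj₁ s  = s
  ... | inj₂ xy = ⊥-elim (x≉y xy)

  noClaw : ∀ {k} z x y w → x ≢ y → x ≢ w → y ≢ w →
           Adj G z x → Adj G z y → Adj G z w →
           colour x ≡ k → colour y ≡ k → colour w ≡ k → colour z ≢ k → ⊥
  noClaw {k} z x y w x≢y x≢w y≢w zx zy zw cx cy cw cz =
    noThreeAlikeMeeting (to z) (to x) (to y) (to w)
      (λ p → x≢y (to-injective p)) (λ p → x≢w (to-injective p)) (λ p → y≢w (to-injective p))
      cx cy cw
      (adjacent⇒ShareEnd zx (other cx)) (adjacent⇒ShareEnd zy (other cy))
      (adjacent⇒ShareEnd zw (other cw))
    where
    other : ∀ {v} → colour v ≡ k → colour z ≢ colour v
    other cv zv = cz (trans zv cv)

record TriangleOverNonEdge (G : Graph) (p q : Fin (n G)) (t : Fin 3 → Fin (n G)) : Set where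
  constructor triangleOverNonEdge
  field
    p≢q      : p ≢ q
    p≁q      : ¬ Adj G p q
    triangle : ∀ i j → i ≢ j → Adj G (t i) (t j)
    p~t      : ∀ i → Adj G p (t i)
    q~t      : ∀ i → Adj G q (t i)

triangleOverNonEdge? : ∀ G p q t → Dec (TriangleOverNonEdge G p q t)
triangleOverNonEdge? G p q t =
  map′ (λ (a , b , c , d , e) → triangleOverNonEdge a b c d e)
       (λ r → let open TriangleOverNonEdge r in p≢q , p≁q , triangle , p~t , q~t)
       (¬? (p ≟ q) ×-dec ¬? (Adj? G p q) ×-dec allOffDiagonal? (λ i j → Adj? G (t i) (t j))
         ×-dec all? (λ i → Adj? G p (t i)) ×-dec all? (λ i → Adj? G q (t i)))

-- Two triangle vertices share a colour, and so does one of p, q; according to the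
-- colour of the third triangle vertex, either it or the other of p, q centres a claw.
TriangleOverNonEdge⇒¬IsProper2ColorLine : ∀ {G p q t} → TriangleOverNonEdge G p q t →
                                          ¬ IsProper2ColorLine G
TriangleOverNonEdge⇒¬IsProper2ColorLine {G} {p} {q} {t} pat (H , φ , proper , G≅CL) =
  [ twoAlike (# 0) (# 1) (# 2) (λ ()) (λ ()) (λ ())
  , [ twoAlike (# 0) (# 2) (# 1) (λ ()) (λ ()) (λ ())
    , twoAlike (# 1) (# 2) (# 0) (λ ()) (λ ()) (λ ()) ] ]
  (majority (colour (t (# 0))) (colour (t (# 1))) (colour (t (# 2))))
  where
  open ColourLineGraph {G} {H} {φ} proper G≅CL
  open TriangleOverNonEdge pat

  p≉q : colour p ≢ colour q
  p≉q = nonadjacent⇒colour≢ p≢q p≁q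

  twoAlikeOf : ∀ v v' → (∀ i → Adj G v (t i)) → (∀ i → Adj G v' (t i)) → colour v' ≢ colour v →
               ∀ i j l → i ≢ j → i ≢ l → j ≢ l →
               colour (t i) ≡ colour v → colour (t j) ≡ colour v → ⊥
  twoAlikeOf v v' v~t v'~t v'≉v i j l i≢j i≢l j≢l tᵢ≡v tⱼ≡v with colour (t l) ≟ colour v
  ... | yes tₗ≡v = noClaw v' (t i) (t j) (t l) (Adj⇒≢ G (triangle i j i≢j))
                     (Adj⇒≢ G (triangle i l i≢l)) (Adj⇒≢ G (triangle j l j≢l))
                     (v'~t i) (v'~t j) (v'~t l) tᵢ≡v tⱼ≡v tₗ≡v v'≉v
  ... | no  tₗ≉v = noClaw (t l) v (t i) (t j) (Adj⇒≢ G (v~t i)) (Adj⇒≢ G (v~t j))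
                     (Adj⇒≢ G (triangle i j i≢j))
                     (Adj-sym G (v~t l)) (triangle l i (≢-sym i≢l)) (triangle l j (≢-sym j≢l))
                     refl tᵢ≡v tⱼ≡v tₗ≉v

  twoAlike : ∀ i j l → i ≢ j → i ≢ l → j ≢ l → colour (t i) ≡ colour (t j) → ⊥
  twoAlike i j l i≢j i≢l j≢l tᵢ≡tⱼ with ≡-or-≡ p≉q (colour (t i))
  ... | inj₁ tᵢ≡p = twoAlikeOf p q p~t q~t (≢-sym p≉q) i j l i≢j i≢l j≢l tᵢ≡p (trans (sym tᵢ≡tⱼ) tᵢ≡p)
  ... | inj₂ tᵢ≡q = twoAlikeOf q p q~t p~t p≉q i j l i≢j i≢l j≢l tᵢ≡q (trans (sym tᵢ≡tⱼ) tᵢ≡q)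

record ApexOverTwoTriangles (G : Graph) (a b : Fin 3 → Fin (n G)) (u : Fin (n G)) : Set where
  constructor apexOverTwoTriangles
  field
    a-triangle : ∀ i j → i ≢ j → Adj G (a i) (a j)
    b-triangle : ∀ i j → i ≢ j → Adj G (b i) (b j)
    u~a        : ∀ i → Adj G u (a i)
    u~b        : ∀ i → Adj G u (b i)
    a≢b        : ∀ i j → i ≢ j → a i ≢ b j
    a≁b        : ∀ i j → i ≢ j → ¬ Adj G (a i) (b j)

apexOverTwoTriangles? : ∀ G a b u → Dec (ApexOverTwoTriangles G a b u)
apexOverTwoTriangles? G a b u =
  map′ (λ (p₁ , p₂ , p₃ , p₄ , p₅ , p₆) → apexOverTwoTriangles p₁ p₂ p₃ p₄ p₅ p₆)
       (λ r → let open ApexOverTwoTriangles r in a-triangle , b-triangle , u~a , u~b , a≢b , a≁b)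
       (allOffDiagonal? (λ i j → Adj? G (a i) (a j)) ×-dec allOffDiagonal? (λ i j → Adj? G (b i) (b j))
         ×-dec all? (λ i → Adj? G u (a i)) ×-dec all? (λ i → Adj? G u (b i))
         ×-dec allOffDiagonal? (λ i j → ¬? (a i ≟ b j))
         ×-dec allOffDiagonal? (λ i j → ¬? (Adj? G (a i) (b j))))

-- The six cross non-edges force each triangle to be monochromatic, in different
-- colours; the apex differs in colour from one of them and is the centre of a claw.
ApexOverTwoTriangles⇒¬IsProper2ColorLine : ∀ {G a b u} → ApexOverTwoTriangles G a b u →
                                           ¬ IsProper2ColorLine G
ApexOverTwoTriangles⇒¬IsProper2ColorLine {G} {a} {b} {u} pat (H , φ , proper , G≅CL) =
  [ (λ u≡a₀ → clawAt-u b b-triangle u~b b-monochromatic (λ u≡b₀ → a≉b₀ (trans (sym u≡a₀) u≡b₀)))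
  , (λ u≡b₀ → clawAt-u a a-triangle u~a a-monochromatic (λ u≡a₀ → a≉b₀ (trans (sym u≡a₀) u≡b₀))) ]
  (≡-or-≡ a≉b₀ (colour u))
  where
  open ColourLineGraph {G} {H} {φ} proper G≅CL
  open ApexOverTwoTriangles pat

  a≉b : ∀ i j → i ≢ j → colour (a i) ≢ colour (b j)
  a≉b i j i≢j = nonadjacent⇒colour≢ (a≢b i j i≢j) (a≁b i j i≢j)

  a-monochromatic : ∀ i → colour (a i) ≡ colour (a (# 0))
  a-monochromatic zero             = refl
  a-monochromatic (suc zero)       = ≢-≢⇒≡ (a≉b (# 1) (# 2) (λ ())) (≢-sym (a≉b (# 0) (# 2) (λ ())))
  a-monochromatic (suc (suc zero)) = ≢-≢⇒≡ (a≉b (# 2) (# 1) (λ ())) (≢-sym (a≉b (# 0) (# 1) (λ ())))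

  b-monochromatic : ∀ i → colour (b i) ≡ colour (b (# 0))
  b-monochromatic zero             = refl
  b-monochromatic (suc zero)       = ≢-≢⇒≡ (≢-sym (a≉b (# 2) (# 1) (λ ()))) (a≉b (# 2) (# 0) (λ ()))
  b-monochromatic (suc (suc zero)) = ≢-≢⇒≡ (≢-sym (a≉b (# 1) (# 2) (λ ()))) (a≉b (# 1) (# 0) (λ ()))

  a≉b₀ : colour (a (# 0)) ≢ colour (b (# 0))
  a≉b₀ a₀≡b₀ = a≉b (# 1) (# 0) (λ ()) (trans (a-monochromatic (# 1)) a₀≡b₀)

  clawAt-u : ∀ {k} (t : Fin 3 → Fin (n G)) → (∀ i j → i ≢ j → Adj G (t i) (t j)) →
             (∀ i → Adj G u (t i)) → (∀ i → colour (t i) ≡ k) → colour u ≢ k → ⊥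
  clawAt-u t triangle u~t t≡k =
    noClaw u (t (# 0)) (t (# 1)) (t (# 2))
      (Adj⇒≢ G (triangle (# 0) (# 1) (λ ()))) (Adj⇒≢ G (triangle (# 0) (# 2) (λ ())))
      (Adj⇒≢ G (triangle (# 1) (# 2) (λ ())))
      (u~t (# 0)) (u~t (# 1)) (u~t (# 2)) (t≡k (# 0)) (t≡k (# 1)) (t≡k (# 2))

mainTheorem12 : ¬ IsProper2ColorLine K5-e × ¬ IsProper2ColorLine F₁ × ¬ IsProper2ColorLine F₂
                  × ¬ IsProper2ColorLine F₃ × ¬ IsProper2ColorLine F₄
-- The pattern only excludes the edges aᵢbⱼ with i ≠ j, so the matching edges of F₂, F₃, F₄
-- do not matter.
mainTheorem12 =
    TriangleOverNonEdge⇒¬IsProper2ColorLine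
      (from-yes (triangleOverNonEdge? K5-e (# 0) (# 1) (lookup (# 2 ∷ # 3 ∷ # 4 ∷ []))))
  , ApexOverTwoTriangles⇒¬IsProper2ColorLine (from-yes (apexOverTwoTriangles? F₁ a b u))
  , ApexOverTwoTriangles⇒¬IsProper2ColorLine (from-yes (apexOverTwoTriangles? F₂ a b u))
  , ApexOverTwoTriangles⇒¬IsProper2ColorLine (from-yes (apexOverTwoTriangles? F₃ a b u))
  , ApexOverTwoTriangles⇒¬IsProper2ColorLine (from-yes (apexOverTwoTriangles? F₄ a b u))
  where
  a b : Fin 3 → Fin 7
  a = lookup (# 0 ∷ # 1 ∷ # 2 ∷ [])
  b = lookup (# 3 ∷ # 4 ∷ # 5 ∷ [])
  u : Fin 7
  u = # 6
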